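{- Fix $m,p\in\mathbb{N}$ and let $a_n=\lfloor n\phi_{mp}/p\rfloor$ and $b_n=\lfloor n(\phi_{mp}+mp)/p\rfloor$ for $n\in\mathbb{N}_0$, where $\phi_k=\frac{2-k+\sqrt{k^2+4}}{2}$. For $n\in\mathbb{N}_0$ define $\varphi_n=\frac{a_n+(mp-1)b_n}{m}$. Then for each $n\in\mathbb{N}$, $\varphi_n$ is the greatest integer $k$ such that $a_k=b_n-1$.
   Context: $\mathbb{N}=\{1,2,\dots\}$, $\mathbb{N}_0=\{0,1,2,\dots\}$. -}

module Defs where

open import Data.Nat using (ℕ)
open import Data.Integer using (ℤ; +_; _+_; _-_; _*_; _≤_; _<_)
open import Data.Product using (_×_)
open import Data.Sum using (_⊎_)

-- For t : ℤ and M, D : ℕ :   t ≤ M·√D   (exact, since M·√D ≥ 0)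
LeMulSqrt : ℤ → ℕ → ℕ → Set
LeMulSqrt t M D = (t ≤ + 0) ⊎ (t * t ≤ + (M Data.Nat.* M Data.Nat.* D))

-- For t : ℤ and M, D : ℕ :   M·√D < t
LtMulSqrt : ℕ → ℕ → ℤ → Set
LtMulSqrt M D t = (+ 0 < t) × (+ (M Data.Nat.* M Data.Nat.* D) < t * t)

-- IsFloor c D e n a  :⇔  a = ⌊ n · (c + √D) / e ⌋   (intended for e > 0),
-- i.e.  e·a ≤ n·c + n·√D < e·(a+1).
IsFloor : ℤ → ℕ → ℕ → ℕ → ℤ → Set
IsFloor c D e n a =
  LeMulSqrt (+ e * a - + n * c) n D × LtMulSqrt n D (+ e * (a + + 1) - + n * c)

-- φ_k = (2 - k + √(k²+4)) / 2, hence
--   n φ_k / p        = n (2 - k + √(k²+4)) / (2p)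
--   n (φ_k + k) / p  = n (2 + k + √(k²+4)) / (2p)
-- IsA k p n a  :⇔  a = ⌊ n φ_k / p ⌋
IsA : ℕ → ℕ → ℕ → ℤ → Set
IsA k p n a = IsFloor (+ 2 - + k) (k Data.Nat.* k Data.Nat.+ 4) (2 Data.Nat.* p) n a

-- IsB k p n b  :⇔  b = ⌊ n (φ_k + k) / p ⌋
IsB : ℕ → ℕ → ℕ → ℤ → Set
IsB k p n b = IsFloor (+ 2 + + k) (k Data.Nat.* k Data.Nat.+ 4) (2 Data.Nat.* p) n b

module Submission where

-- Proof of Theorem 5.1.  Write K = mp, D = K² + 4 and s = √D, so that φ_K = (2 - K + s)/2,
-- a_n = ⌊n(2 - K + s)/2p⌋ and b_n = ⌊n(2 + K + s)/2p⌋.  Fix n ≥ 1, put b = b_n and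
-- k = p·b - n, which equals φ_n because a_n = b - mn.  Everything reduces to comparing
-- integers with multiples of s, where t ≤ νs means t ≤ 0 or t² ≤ ν²D.  With
-- T = 2k - Kn and R = Kk + 2n the floor condition for b reads T ≤ ns < T + 2p, and the
-- claims are R - 2p ≤ ks < R (that is a_k = b - 1) and (k+1)s ≥ K(k+1) + 2(n-1)
-- (that is a_{k+1} ≥ b, which forces every j with a_j = b - 1 to satisfy j ≤ k).
-- The engine is the Gaussian norm identity R² + T² = (k² + n²)D, coming from
-- (K + 2i)(k - ni) = R + Ti: it turns a strict bound T < ns into ks < R, and likewise
-- for the shifted pair (k + 1, n - 1).  Strictness of T < ns holds because n²D is
-- never a perfect square.

open import Defs
open import Data.Nat as ℕ using (ℕ; suc; z≤n; NonZero)
  renaming (_*_ to _*ℕ_; _+_ to _+ℕ_; _≤_ to _≤ℕ_)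
import Data.Nat.Properties as ℕP
open import Data.Nat.Divisibility using (_∣_; divides; ∣-refl)
open import Data.Nat.GCD using (gcd; GCD; gcd-GCD; GCD-*; gcd[m,n]∣m; gcd[m,n]∣n; gcd[m,n]≢0)
open import Data.Nat.Coprimality using (Coprime; GCD≡1⇒coprime; coprime-divisor)
  renaming (sym to coprime-sym)
import Data.Nat.Tactic.RingSolver as ℕRing
open import Data.Integer using (ℤ; +_; +[1+_]; _+_; _-_; -_; _*_; _≤_; _<_; ∣_∣; +≤+;
  nonNegative)
import Data.Integer.Properties as ℤP
open import Data.Integer.Tactic.RingSolver using (solve-∀)
open import Data.Product using (Σ; _×_; _,_; proj₁; proj₂)
open import Data.Sum using (_⊎_; inj₁; inj₂; [_,_]′)
open import Data.Empty using (⊥-elim)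
open import Relation.Nullary using (yes; no)
open import Relation.Binary.Definitions using (tri<; tri≈; tri>)
open import Relation.Binary.PropositionalEquality
  using (_≡_; _≢_; refl; sym; trans; cong; cong₂; subst; subst₂; module ≡-Reasoning)

-- Integer inequalities by certificate: an inequality is established by exhibiting the
-- difference of its two sides as an explicitly nonnegative term (checked by the ring solver).

0≤+ : ∀ {x y} → + 0 ≤ x → + 0 ≤ y → + 0 ≤ x + y
0≤+ = ℤP.+-mono-≤

0≤* : ∀ {x y} → + 0 ≤ x → + 0 ≤ y → + 0 ≤ x * y
0≤* {+ m} {+ n} _ _ = subst (+ 0 ≤_) (ℤP.pos-* m n) (+≤+ z≤n)

0≤+n : ∀ n → + 0 ≤ + n
0≤+n n = +≤+ z≤n

1≤⇒0≤ : ∀ {x} → + 1 ≤ x → + 0 ≤ x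
1≤⇒0≤ = ℤP.≤-trans (+≤+ z≤n)

≤-by : ∀ {x y} c → + 0 ≤ c → y ≡ x + c → x ≤ y
≤-by {x} c 0≤c refl = ℤP.≤-trans (ℤP.≤-reflexive (sym (ℤP.+-identityʳ x))) (ℤP.+-monoʳ-≤ x 0≤c)

<-by : ∀ {x y} c → + 0 ≤ c → y ≡ + 1 + x + c → x < y
<-by c 0≤c eq = ℤP.suc[i]≤j⇒i<j (≤-by c 0≤c eq)

≤-slack : ∀ {x y} → x ≤ y → + 0 ≤ y - x
≤-slack = ℤP.i≤j⇒0≤j-i

<-slack : ∀ {x y} → x < y → + 0 ≤ y - (+ 1 + x)
<-slack x<y = ℤP.i≤j⇒0≤j-i (ℤP.i<j⇒suc[i]≤j x<y)

square-mono-≤ : ∀ {x y} → + 0 ≤ x → x ≤ y → x * x ≤ y * y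
square-mono-≤ {x} {y} 0≤x x≤y =
  ≤-by _ (0≤* (≤-slack x≤y) (0≤+ (0≤+ (≤-slack x≤y) 0≤x) 0≤x)) (expand x y)
  where
  expand : ∀ x y → y * y ≡ x * x + (y - x) * (y - x + x + x)
  expand = solve-∀

square-mono-< : ∀ {x y} → + 0 ≤ x → x < y → x * x < y * y
square-mono-< {x} {y} 0≤x x<y =
  <-by _ (0≤+ (0≤* (0≤* (0≤+n 2) 0≤x) (0≤+ (0≤+n 1) d)) (0≤* d (0≤+ (0≤+n 2) d))) (expand x y)
  where
  d : + 0 ≤ y - (+ 1 + x)
  d = <-slack x<y
  expand : ∀ x y → y * y ≡ + 1 + x * x
    + (+ 2 * x * (+ 1 + (y - (+ 1 + x))) + (y - (+ 1 + x)) * (+ 2 + (y - (+ 1 + x))))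
  expand = solve-∀

isolate : ∀ {x y u v} → x + y ≡ u + v → u ≡ x + y - v
isolate {x} {y} {u} {v} eq = trans (add-sub u v) (cong (_- v) (sym eq))
  where
  add-sub : ∀ u v → u ≡ u + v - v
  add-sub = solve-∀

exchange : ∀ {x y u v} → x + y ≡ u + v → y < v → u < x
exchange {x} {y} {u} {v} eq y<v =
  <-by _ (<-slack y<v) (trans (isolate {u} {v} {x} {y} (sym eq)) (regroup u v y))
  where
  regroup : ∀ u v y → u + v - y ≡ + 1 + u + (v - (+ 1 + y))
  regroup = solve-∀

≤⊎> : ∀ x y → x ≤ y ⊎ y < x
≤⊎> x y with x ℤP.≤? y
... | yes x≤y = inj₁ x≤y
... | no x≰y = inj₂ (ℤP.≰⇒> x≰y)

-- Comparison with square roots:  t ≤√ Q  means t ≤ √Q,  t >√ Q  means √Q < t.  These are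
-- exactly the predicates LeMulSqrt / LtMulSqrt of Defs with Q = ν²D.

infix 4 _≤√_ _>√_

_≤√_ : ℤ → ℤ → Set
t ≤√ Q = t ≤ + 0 ⊎ t * t ≤ Q

_>√_ : ℤ → ℤ → Set
t >√ Q = + 0 < t × Q < t * t

≤√>√⇒< : ∀ {t u Q} → t ≤√ Q → u >√ Q → t < u
≤√>√⇒< (inj₁ t≤0) (0<u , _) = ℤP.≤-<-trans t≤0 0<u
≤√>√⇒< {t} {u} (inj₂ t²≤Q) (0<u , Q<u²) with t ℤP.<? u
... | yes t<u = t<u
... | no t≮u = ⊥-elim (ℤP.<-irrefl refl
  (ℤP.≤-<-trans (ℤP.≤-trans (square-mono-≤ (ℤP.<⇒≤ 0<u) (ℤP.≮⇒≥ t≮u)) t²≤Q) Q<u²))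

>√-scale : ∀ {D n n' A C} → + 1 ≤ n → + 0 ≤ n' → + 0 < C → n' * A ≤ n * C →
           A >√ n * n * D → C >√ n' * n' * D
>√-scale {n' = + 0} _ _ 0<C _ _ = 0<C , square-mono-< ℤP.≤-refl 0<C
>√-scale {D} {n} {n'@(+[1+ m ])} {A} {C} 1≤n _ 0<C n'A≤nC (0<A , n²D<A²) = 0<C ,
  ℤP.*-cancelˡ-<-nonNeg (n * n) {{nonNegative (0≤* 0≤n 0≤n)}} (begin-strict
    n * n * (n' * n' * D)  ≡⟨ swap (n * n) (n' * n') D ⟩
    n' * n' * (n * n * D)  <⟨ ℤP.*-monoˡ-<-pos (n' * n') n²D<A² ⟩
    n' * n' * (A * A)      ≡⟨ square-product n' A ⟩
    n' * A * (n' * A)      ≤⟨ square-mono-≤ (0≤* {n'} {A} (0≤+n (suc m)) (ℤP.<⇒≤ 0<A)) n'A≤nC ⟩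
    n * C * (n * C)        ≡⟨ sym (square-product n C) ⟩
    n * n * (C * C)        ∎)
  where
  open ℤP.≤-Reasoning
  0≤n : + 0 ≤ n
  0≤n = 1≤⇒0≤ 1≤n
  swap : ∀ x y z → x * (y * z) ≡ y * (x * z)
  swap = solve-∀
  square-product : ∀ x y → x * x * (y * y) ≡ x * y * (x * y)
  square-product = solve-∀

-- Floors:  Floor c e ν Q x  says  e·x - ν·c ≤ √Q < e·(x+1) - ν·c, i.e. x = ⌊(νc + √Q)/e⌋.
-- Defs.IsFloor c D e ν x is definitionally Floor c (+ e) (+ ν) (+ (ν·ν·D)) x.

Floor : ℤ → ℤ → ℤ → ℤ → ℤ → Set
Floor c e ν Q x = e * x - ν * c ≤√ Q × e * (x + + 1) - ν * c >√ Q

Floor-cong : ∀ {c c' e e' ν ν' Q Q' x} → c ≡ c' → e ≡ e' → ν ≡ ν' → Q ≡ Q' →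
             Floor c e ν Q x → Floor c' e' ν' Q' x
Floor-cong refl refl refl refl f = f

-- A floor is determined by its defining inequalities (for a positive denominator e):
-- e·x - νc ≤ √Q < e·(y+1) - νc forces x < y + 1.
floor-≤ : ∀ {c e ν Q x y} → + 0 < e → Floor c e ν Q x → Floor c e ν Q y → x ≤ y
floor-≤ {c} {e} {ν} {Q} {x} {y} 0<e (lower , _) (_ , upper) =
  ≤-by _ (<-slack x<y+1) (regroup x y)
  where
  ex<e[y+1] : e * x < e * (y + + 1)
  ex<e[y+1] = <-by _ (<-slack (≤√>√⇒< lower upper)) (shift e x y (ν * c))
    where
    shift : ∀ e x y w → e * (y + + 1)
            ≡ + 1 + e * x + (e * (y + + 1) - w - (+ 1 + (e * x - w)))
    shift = solve-∀
  x<y+1 : x < y + + 1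
  x<y+1 = ℤP.*-cancelˡ-<-nonNeg e {{nonNegative (ℤP.<⇒≤ 0<e)}} ex<e[y+1]
  regroup : ∀ x y → y ≡ x + (y + + 1 - (+ 1 + x))
  regroup = solve-∀

floor-unique : ∀ {c e ν Q x y} → + 0 < e → Floor c e ν Q x → Floor c e ν Q y → x ≡ y
floor-unique {c} {e} {ν} {Q} 0<e fx fy =
  ℤP.≤-antisym (floor-≤ {c} {e} {ν} {Q} 0<e fx fy) (floor-≤ {c} {e} {ν} {Q} 0<e fy fx)

-- Non-squareness.  K² + 4 (K ≥ 1) is not a perfect square: it lies strictly between K²
-- and (K+2)², and (K+1)² = K² + 4 would make the odd number 2K + 1 equal to 4.
sq+4-not-square : ∀ K q → 1 ≤ℕ K → q *ℕ q ≢ K *ℕ K +ℕ 4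
sq+4-not-square K q 1≤K q²≡ with ℕP.<-cmp q (suc K)
... | tri< q<1+K _ _ = ℕP.<-irrefl q²≡ (begin-strict
      q *ℕ q      ≤⟨ ℕP.*-mono-≤ q≤K q≤K ⟩
      K *ℕ K      <⟨ ℕP.m<m+n (K *ℕ K) (ℕ.s≤s z≤n) ⟩
      K *ℕ K +ℕ 4 ∎)
  where
  open ℕP.≤-Reasoning
  q≤K : q ≤ℕ K
  q≤K = ℕ.s≤s⁻¹ q<1+K
... | tri≈ _ refl _ =
  ℕP.even≢odd 2 K (sym (ℕP.+-cancelˡ-≡ (K *ℕ K) _ _ (trans (sym (expand K)) q²≡)))
  where
  expand : ∀ K → suc K *ℕ suc K ≡ K *ℕ K +ℕ suc (2 *ℕ K)
  expand = ℕRing.solve-∀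
... | tri> _ _ 1+K<q = ℕP.<-irrefl (sym q²≡) (begin-strict
      K *ℕ K +ℕ 4                 <⟨ ℕP.m<m+n (K *ℕ K +ℕ 4) 0<4K ⟩
      K *ℕ K +ℕ 4 +ℕ 4 *ℕ K       ≡⟨ expand K ⟩
      (2 +ℕ K) *ℕ (2 +ℕ K)        ≤⟨ ℕP.*-mono-≤ 1+K<q 1+K<q ⟩
      q *ℕ q                      ∎)
  where
  open ℕP.≤-Reasoning
  0<4K : 0 ℕ.< 4 *ℕ K
  0<4K = ℕP.<-≤-trans (ℕ.s≤s z≤n) (ℕP.*-monoʳ-≤ 4 1≤K)
  expand : ∀ K → K *ℕ K +ℕ 4 +ℕ 4 *ℕ K ≡ (2 +ℕ K) *ℕ (2 +ℕ K)
  expand = ℕRing.solve-∀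

-- If t² = n²D with n ≠ 0 then D is a perfect square: write t = q₁g and n = q₂g with
-- g = gcd(t, n); then q₁² = q₂²D with q₁, q₂ coprime, so q₂ ∣ q₁ and hence q₂ = 1.
rational-square : ∀ t n D → .{{NonZero n}} → t *ℕ t ≡ n *ℕ n *ℕ D → Σ ℕ λ q → q *ℕ q ≡ D
rational-square t n D t²≡n²D =
  q₁ , trans q₁²≡q₂²D (trans (cong (λ x → x *ℕ x *ℕ D) q₂≡1) (ℕP.*-identityˡ D))
  where
  g : ℕ
  g = gcd t n
  instance
    g≢0 : NonZero g
    g≢0 = ℕ.≢-nonZero (gcd[m,n]≢0 t n (inj₂ (ℕ.≢-nonZero⁻¹ n)))
    g²≢0 : NonZero (g *ℕ g)
    g²≢0 = ℕP.m*n≢0 g g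
  q₁ q₂ : ℕ
  q₁ = _∣_.quotient (gcd[m,n]∣m t n)
  q₂ = _∣_.quotient (gcd[m,n]∣n t n)
  t≡q₁g : t ≡ q₁ *ℕ g
  t≡q₁g = _∣_.equality (gcd[m,n]∣m t n)
  n≡q₂g : n ≡ q₂ *ℕ g
  n≡q₂g = _∣_.equality (gcd[m,n]∣n t n)
  coprime : Coprime q₁ q₂
  coprime = GCD≡1⇒coprime (GCD-* (subst₂ (λ x y → GCD x y (1 *ℕ g)) t≡q₁g n≡q₂g
    (subst (GCD t n) (sym (ℕP.*-identityˡ g)) (gcd-GCD t n))))
  q₁²≡q₂²D : q₁ *ℕ q₁ ≡ q₂ *ℕ q₂ *ℕ D
  q₁²≡q₂²D = ℕP.*-cancelʳ-≡ _ _ (g *ℕ g) (begin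
    q₁ *ℕ q₁ *ℕ (g *ℕ g)          ≡⟨ regroup q₁ g ⟩
    q₁ *ℕ g *ℕ (q₁ *ℕ g)          ≡⟨ cong (λ x → x *ℕ x) (sym t≡q₁g) ⟩
    t *ℕ t                        ≡⟨ t²≡n²D ⟩
    n *ℕ n *ℕ D                   ≡⟨ cong (λ x → x *ℕ x *ℕ D) n≡q₂g ⟩
    q₂ *ℕ g *ℕ (q₂ *ℕ g) *ℕ D     ≡⟨ regroup' q₂ g D ⟩
    q₂ *ℕ q₂ *ℕ D *ℕ (g *ℕ g)     ∎)
    where
    open ≡-Reasoning
    regroup : ∀ q g → q *ℕ q *ℕ (g *ℕ g) ≡ q *ℕ g *ℕ (q *ℕ g)
    regroup = ℕRing.solve-∀
    regroup' : ∀ q g D → q *ℕ g *ℕ (q *ℕ g) *ℕ D ≡ q *ℕ q *ℕ D *ℕ (g *ℕ g)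
    regroup' = ℕRing.solve-∀
  q₂∣q₁ : q₂ ∣ q₁
  q₂∣q₁ = coprime-divisor (coprime-sym coprime)
                          (divides (q₂ *ℕ D) (trans q₁²≡q₂²D (comm q₂ D)))
    where
    comm : ∀ q D → q *ℕ q *ℕ D ≡ q *ℕ D *ℕ q
    comm = ℕRing.solve-∀
  q₂≡1 : q₂ ≡ 1
  q₂≡1 = coprime (q₂∣q₁ , ∣-refl)

not-square : ∀ t n K → 1 ≤ℕ n → 1 ≤ℕ K → t *ℕ t ≢ n *ℕ n *ℕ (K *ℕ K +ℕ 4)
not-square t n K 1≤n 1≤K t²≡n²D = sq+4-not-square K (proj₁ root) 1≤K (proj₂ root)
  where
  root : Σ ℕ λ q → q *ℕ q ≡ K *ℕ K +ℕ 4
  root = rational-square t n (K *ℕ K +ℕ 4) {{ℕ.>-nonZero 1≤n}} t²≡n²D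

disc : ℤ → ℤ
disc K = K * K + + 4

-- Multiplicativity of the Gaussian norm: (K + 2i)(k - ni) = (Kk + 2n) + (2k - Kn)i, hence
-- (Kk + 2n)² + (2k - Kn)² = (k² + n²)(K² + 4).
gaussian-norm : ∀ K k n →
  (K * k + + 2 * n) * (K * k + + 2 * n) + (+ 2 * k - K * n) * (+ 2 * k - K * n)
  ≡ k * k * (K * K + + 4) + n * n * (K * K + + 4)
gaussian-norm = solve-∀

-- The slack (K - 2)k + (K + 2)n - 2P, written as R - T - 2P below, is nonnegative.  For K ≥ 2
-- this needs only k ≥ 1; for K = 1 it needs the upper bound k < 2n.
lower-slack : ∀ {K P k n} → + 1 ≤ K → P ≤ K → + 1 ≤ k → + 1 ≤ n → k < (K + + 1) * n →
              + 0 ≤ K * k + + 2 * n - (+ 2 * k - K * n) - + 2 * P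
lower-slack {K} {P} {k} {n} 1≤K P≤K 1≤k 1≤n k<[K+1]n =
  [ K≤1-case , 1<K-case ]′ (≤⊎> K (+ 1))
  where
  K≤1-case : K ≤ + 1 → + 0 ≤ K * k + + 2 * n - (+ 2 * k - K * n) - + 2 * P
  K≤1-case K≤1 =
    ≤-by _ (0≤+ (0≤+ (0≤+ (0≤+ (0≤* (≤-slack 1≤K) (1≤⇒0≤ 1≤k)) (<-slack k<[K+1]n))
                          (≤-slack 1≤n))
                     (0≤* (0≤+n 2) (≤-slack K≤1)))
                (0≤* (0≤+n 2) (≤-slack P≤K)))
           (certificate K P k n)
    where
    certificate : ∀ K P k n → K * k + + 2 * n - (+ 2 * k - K * n) - + 2 * P
                  ≡ + 0 + ((K - + 1) * k + ((K + + 1) * n - (+ 1 + k)) + (n - + 1)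
                            + + 2 * (+ 1 - K) + + 2 * (K - P))
    certificate = solve-∀
  1<K-case : + 1 < K → + 0 ≤ K * k + + 2 * n - (+ 2 * k - K * n) - + 2 * P
  1<K-case 1<K =
    ≤-by _ (0≤+ (0≤+ (0≤* (<-slack 1<K) (≤-slack 1≤k)) (0≤* 0≤K+2 (≤-slack 1≤n)))
                  (0≤* (0≤+n 2) (≤-slack P≤K)))
           (certificate K P k n)
    where
    0≤K+2 : + 0 ≤ K + + 2
    0≤K+2 = 0≤+ (1≤⇒0≤ 1≤K) (0≤+n 2)
    certificate : ∀ K P k n → K * k + + 2 * n - (+ 2 * k - K * n) - + 2 * P
                  ≡ + 0 + ((K - (+ 1 + + 1)) * (k - + 1) + (K + + 2) * (n - + 1)
                            + + 2 * (K - P))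
    certificate = solve-∀

module BeattyPair (M P n b : ℤ) (1≤M : + 1 ≤ M) (1≤P : + 1 ≤ P) (1≤n : + 1 ≤ n)
  (irrational : ∀ t → t * t ≢ n * n * disc (M * P))
  (b-floor : Floor (+ 2 + M * P) (+ 2 * P) n (n * n * disc (M * P)) b) where

  K D : ℤ
  K = M * P
  D = disc K
  -- the candidate φ_n, and the real and imaginary parts of (K + 2i)(k - ni)
  k T R : ℤ
  k = P * b - n
  T = + 2 * k - K * n
  R = K * k + + 2 * n

  0≤n : + 0 ≤ n
  0≤n = 1≤⇒0≤ 1≤n

  P≤K : P ≤ K
  P≤K = ≤-by _ (0≤* (≤-slack 1≤M) (1≤⇒0≤ 1≤P)) (certificate M P)
    where
    certificate : ∀ M P → M * P ≡ P + (M - + 1) * P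
    certificate = solve-∀

  1≤K : + 1 ≤ K
  1≤K = ℤP.≤-trans 1≤P P≤K

  0<2P : + 0 < + 2 * P
  0<2P = <-by _ (0≤+ (1≤⇒0≤ 1≤P) (≤-slack 1≤P)) (certificate P)
    where
    certificate : ∀ P → + 2 * P ≡ + 1 + + 0 + (P + (P - + 1))
    certificate = solve-∀

  T≤n√D : T ≤√ n * n * D
  T≤n√D = subst (_≤√ n * n * D) (rewrite-gap K P n b) (proj₁ b-floor)
    where
    rewrite-gap : ∀ K P n b → + 2 * P * b - n * (+ 2 + K) ≡ + 2 * (P * b - n) - K * n
    rewrite-gap = solve-∀

  n√D<T+2P : T + + 2 * P >√ n * n * D
  n√D<T+2P = subst (_>√ n * n * D) (rewrite-gap K P n b) (proj₂ b-floor)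
    where
    rewrite-gap : ∀ K P n b → + 2 * P * (b + + 1) - n * (+ 2 + K)
                  ≡ + 2 * (P * b - n) - K * n + + 2 * P
    rewrite-gap = solve-∀

  -- K < √D, so Kn < n√D < T + 2P.
  [Kn]²<n²D : K * n * (K * n) < n * n * D
  [Kn]²<n²D = <-by _ (0≤+ (0≤+n 3) (0≤* (0≤+n 4) (0≤+ (0≤* (≤-slack 1≤n) (≤-slack 1≤n))
                                                      (0≤* (0≤+n 2) (≤-slack 1≤n)))))
                     (certificate K n)
    where
    certificate : ∀ K n → n * n * (K * K + + 4)
                  ≡ + 1 + K * n * (K * n)
                    + (+ 3 + + 4 * ((n - + 1) * (n - + 1) + + 2 * (n - + 1)))
    certificate = solve-∀

  Kn<T+2P : K * n < T + + 2 * P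
  Kn<T+2P = ≤√>√⇒< (inj₂ (ℤP.<⇒≤ [Kn]²<n²D)) n√D<T+2P

  -- φ_n ≥ 1: 2k = T + Kn > 2Kn - 2P ≥ 0.
  0<k : + 0 < k
  0<k = ℤP.*-cancelˡ-<-nonNeg (+ 2)
    (<-by _ (0≤+ (0≤+ (<-slack Kn<T+2P) (0≤* (0≤+n 2) (0≤* (≤-slack P≤K) 0≤n)))
                 (0≤* (0≤+n 2) (0≤* (1≤⇒0≤ 1≤P) (≤-slack 1≤n))))
          (certificate K k n P))
    where
    certificate : ∀ K k n P → + 2 * k ≡ + 1 + + 0
      + ((+ 2 * k - K * n + + 2 * P - (+ 1 + K * n)) + + 2 * ((K - P) * n)
         + + 2 * (P * (n - + 1)))
    certificate = solve-∀

  1≤k : + 1 ≤ k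
  1≤k = ℤP.i<j⇒suc[i]≤j 0<k

  0≤k : + 0 ≤ k
  0≤k = ℤP.<⇒≤ 0<k

  -- T < n√D strictly; in squared form T² < n²D.  For T ≤ 0 use |T| ≤ Kn < n√D,
  -- otherwise the irrationality of n√D.
  T²<n²D : T * T < n * n * D
  T²<n²D = [ nonpositive , (λ T²≤n²D → ℤP.≤∧≢⇒< T²≤n²D (irrational T)) ]′ T≤n√D
    where
    nonpositive : T ≤ + 0 → T * T < n * n * D
    nonpositive T≤0 =
      ℤP.≤-<-trans (subst (_≤ K * n * (K * n)) (negate-square T) [-T]²≤[Kn]²) [Kn]²<n²D
      where
      negate-square : ∀ x → (- x) * (- x) ≡ x * x
      negate-square = solve-∀
      certificate : ∀ K k n → K * n ≡ - (+ 2 * k - K * n) + + 2 * k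
      certificate = solve-∀
      [-T]²≤[Kn]² : (- T) * (- T) ≤ K * n * (K * n)
      [-T]²≤[Kn]² = square-mono-≤ (ℤP.neg-mono-≤ T≤0)
                                  (≤-by _ (0≤* (0≤+n 2) 0≤k) (certificate K k n))

  -- a_k ≤ b - 1:  k√D < R, since R² = (k² + n²)D - T² > k²D.
  k√D<R : R >√ k * k * D
  k√D<R = <-by _ (0≤+ (0≤+ (0≤* (1≤⇒0≤ 1≤K) 0≤k) (0≤* (0≤+n 2) (≤-slack 1≤n))) (0≤+n 1))
                 (certificate K k n)
        , exchange (gaussian-norm K k n) T²<n²D
    where
    certificate : ∀ K k n → K * k + + 2 * n ≡ + 1 + + 0 + (K * k + + 2 * (n - + 1) + + 1)
    certificate = solve-∀

  -- √D < K + 2 gives T < (K + 2)n, i.e. k < (K + 1)n.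
  k<[K+1]n : k < (K + + 1) * n
  k<[K+1]n = ℤP.*-cancelˡ-<-nonNeg (+ 2) (<-by _ (<-slack T<[K+2]n) (certificate K k n))
    where
    n√D<[K+2]n : (K + + 2) * n >√ n * n * D
    n√D<[K+2]n =
      <-by _ (0≤+ (0≤+ (0≤* (1≤⇒0≤ 1≤K) 0≤n) (0≤* (0≤+n 2) (≤-slack 1≤n))) (0≤+n 1))
             (positivity K n) ,
      <-by _ (0≤+ (0≤+ (0≤* (0≤+n 4) (0≤* (≤-slack 1≤K) (0≤* 0≤n 0≤n)))
                       (0≤* (0≤+n 4) (0≤+ (0≤* (≤-slack 1≤n) (≤-slack 1≤n))
                                          (0≤* (0≤+n 2) (≤-slack 1≤n)))))
                  (0≤+n 3))
             (square-gap K n)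
      where
      positivity : ∀ K n → (K + + 2) * n ≡ + 1 + + 0 + (K * n + + 2 * (n - + 1) + + 1)
      positivity = solve-∀
      square-gap : ∀ K n → (K + + 2) * n * ((K + + 2) * n) ≡ + 1 + n * n * (K * K + + 4)
        + (+ 4 * ((K - + 1) * (n * n)) + + 4 * ((n - + 1) * (n - + 1) + + 2 * (n - + 1)) + + 3)
      square-gap = solve-∀
    T<[K+2]n : T < (K + + 2) * n
    T<[K+2]n = ≤√>√⇒< T≤n√D n√D<[K+2]n
    certificate : ∀ K k n → + 2 * ((K + + 1) * n)
                  ≡ + 1 + + 2 * k + ((K + + 2) * n - (+ 1 + (+ 2 * k - K * n)))
    certificate = solve-∀

  -- b - 1 ≤ a_k:  R - 2P ≤ k√D, since k²D = R² + T² - n²D and n²D < (T + 2P)².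
  R-2P≤k√D : R - + 2 * P ≤√ k * k * D
  R-2P≤k√D = inj₂ (≤-by _ (0≤+ (0≤+ (<-slack (proj₂ n√D<T+2P)) (0≤+n 1))
                              (0≤* (0≤* (0≤+n 4) (1≤⇒0≤ 1≤P))
                                   (lower-slack 1≤K P≤K 1≤k 1≤n k<[K+1]n)))
                          (begin
    k * k * D                   ≡⟨ isolate {R * R} {T * T} (gaussian-norm K k n) ⟩
    R * R + T * T - n * n * D   ≡⟨ complete-square R T P (n * n * D) ⟩
    (R - + 2 * P) * (R - + 2 * P) + ((T + + 2 * P) * (T + + 2 * P) - (+ 1 + n * n * D) + + 1
                                      + + 4 * P * (R - T - + 2 * P)) ∎))
    where
    open ≡-Reasoning
    complete-square : ∀ R T P Q → R * R + T * T - Q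
      ≡ (R - + 2 * P) * (R - + 2 * P) + ((T + + 2 * P) * (T + + 2 * P) - (+ 1 + Q) + + 1
                                          + + 4 * P * (R - T - + 2 * P))
    complete-square = solve-∀

  C R₁ : ℤ
  C = + 2 * (k + + 1) - K * (n - + 1)
  R₁ = K * (k + + 1) + + 2 * (n - + 1)

  -- (n - 1)√D < C, by scaling n√D < T + 2P with the factor (n - 1)/n.
  [n-1]√D<C : C >√ (n - + 1) * (n - + 1) * D
  [n-1]√D<C = >√-scale 1≤n (≤-slack 1≤n) 0<C
    (≤-by _ (0≤+ (0≤+ (0≤+ (<-slack Kn<T+2P) (0≤+n 1))
                      (0≤* (0≤* (0≤+n 2) 0≤n) (≤-slack P≤K)))
                 (0≤* (0≤+n 2) 0≤n))
            (certificate K k n P))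
    n√D<T+2P
    where
    0<C : + 0 < C
    0<C = <-by _ (0≤+ (0≤+ (0≤+ (<-slack Kn<T+2P) (0≤* (1≤⇒0≤ 1≤K) (≤-slack 1≤n)))
                           (0≤* (0≤+n 2) (≤-slack P≤K)))
                      (0≤+n 2))
               (positivity K k n P)
      where
      positivity : ∀ K k n P → + 2 * (k + + 1) - K * (n - + 1) ≡ + 1 + + 0
        + ((+ 2 * k - K * n + + 2 * P - (+ 1 + K * n)) + K * (n - + 1) + + 2 * (K - P) + + 2)
      positivity = solve-∀
    certificate : ∀ K k n P → n * (+ 2 * (k + + 1) - K * (n - + 1))
      ≡ (n - + 1) * (+ 2 * k - K * n + + 2 * P)
        + ((+ 2 * k - K * n + + 2 * P - (+ 1 + K * n)) + + 1 + + 2 * n * (K - P) + + 2 * n)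
    certificate = solve-∀

  -- a_{k+1} ≥ b:  R₁ < (k + 1)√D, by the norm identity for (k + 1, n - 1).
  R₁²<[k+1]²D : R₁ * R₁ < (k + + 1) * (k + + 1) * D
  R₁²<[k+1]²D = exchange (sym (gaussian-norm K (k + + 1) (n - + 1))) (proj₂ [n-1]√D<C)

  -- φ_n is maximal: if a_J = b - 1 then J√D < 2Pb - J(2 - K), and rescaling this bound from J
  -- to k + 1 ≤ J would give (k + 1)√D < R₁, contradicting the previous step.
  k-maximal : ∀ J → Floor (+ 2 - K) (+ 2 * P) J (J * J * D) (b - + 1) → J ≤ k
  k-maximal J (_ , J√D<RJ) = [ (λ J≤k → J≤k) , contradiction ]′ (≤⊎> J k)
    where
    contradiction : k < J → J ≤ k
    contradiction k<J = ⊥-elim (ℤP.<-asym R₁²<[k+1]²D (proj₂ (>√-scale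
      (ℤP.≤-trans 1≤k (ℤP.<⇒≤ k<J)) (0≤+ 0≤k (0≤+n 1)) 0<R₁
      (≤-by _ (0≤* (0≤* (0≤+n 2) 0≤Pb) (<-slack k<J)) (certificate K P n b J))
      J√D<RJ)))
      where
      0≤Pb : + 0 ≤ P * b
      0≤Pb = ≤-by _ (0≤+ 0≤k 0≤n) (split P b n)
        where
        split : ∀ P b n → P * b ≡ + 0 + (P * b - n + n)
        split = solve-∀
      0<R₁ : + 0 < R₁
      0<R₁ = <-by _ (0≤+ (0≤+ (0≤* (1≤⇒0≤ 1≤K) 0≤k) (≤-slack 1≤K))
                         (0≤* (0≤+n 2) (≤-slack 1≤n)))
                  (positivity K k n)
        where
        positivity : ∀ K k n → K * (k + + 1) + + 2 * (n - + 1)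
                     ≡ + 1 + + 0 + (K * k + (K - + 1) + + 2 * (n - + 1))
        positivity = solve-∀
      certificate : ∀ K P n b J → J * (K * (P * b - n + + 1) + + 2 * (n - + 1))
        ≡ (P * b - n + + 1) * (+ 2 * P * (b - + 1 + + 1) - J * (+ 2 - K))
          + + 2 * (P * b) * (J - (+ 1 + (P * b - n)))
      certificate = solve-∀

  -- a_n = b - Mn: the floors defining a_n and b_n differ by the integer nK/P = Mn.
  a-floor-at-n : Floor (+ 2 - K) (+ 2 * P) n (n * n * D) (b - M * n)
  a-floor-at-n = subst (_≤√ n * n * D) (shift M P n b) (proj₁ b-floor)
               , subst (_>√ n * n * D) (shift⁺ M P n b) (proj₂ b-floor)
    where
    shift : ∀ M P n b → + 2 * P * b - n * (+ 2 + M * P)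
            ≡ + 2 * P * (b - M * n) - n * (+ 2 - M * P)
    shift = solve-∀
    shift⁺ : ∀ M P n b → + 2 * P * (b + + 1) - n * (+ 2 + M * P)
             ≡ + 2 * P * (b - M * n + + 1) - n * (+ 2 - M * P)
    shift⁺ = solve-∀

  a-unique : ∀ ν {x y} → Floor (+ 2 - K) (+ 2 * P) ν (ν * ν * D) x →
             Floor (+ 2 - K) (+ 2 * P) ν (ν * ν * D) y → x ≡ y
  a-unique ν = floor-unique {+ 2 - K} {+ 2 * P} {ν} {ν * ν * D} 0<2P

  a-floor-at-k : Floor (+ 2 - K) (+ 2 * P) k (k * k * D) (b - + 1)
  a-floor-at-k = subst (_≤√ k * k * D) (rewrite-gap K P n b) R-2P≤k√D
               , subst (_>√ k * k * D) (rewrite-gap⁺ K P n b) k√D<R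
    where
    rewrite-gap : ∀ K P n b → K * (P * b - n) + + 2 * n - + 2 * P
                  ≡ + 2 * P * (b - + 1) - (P * b - n) * (+ 2 - K)
    rewrite-gap = solve-∀
    rewrite-gap⁺ : ∀ K P n b → K * (P * b - n) + + 2 * n
                   ≡ + 2 * P * (b - + 1 + + 1) - (P * b - n) * (+ 2 - K)
    rewrite-gap⁺ = solve-∀

  Mk≡ : M * k ≡ (b - M * n) + (K - + 1) * b
  Mk≡ = expand M P n b
    where
    expand : ∀ M P n b → M * (P * b - n) ≡ (b - M * n) + (M * P - + 1) * b
    expand = solve-∀

pos-bound : ∀ ν m p → + (ν *ℕ ν *ℕ (m *ℕ p *ℕ (m *ℕ p) +ℕ 4)) ≡ + ν * + ν * disc (+ m * + p)
pos-bound ν m p = begin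
  + (ν *ℕ ν *ℕ (m *ℕ p *ℕ (m *ℕ p) +ℕ 4))   ≡⟨ ℤP.pos-* (ν *ℕ ν) _ ⟩
  + (ν *ℕ ν) * + (m *ℕ p *ℕ (m *ℕ p) +ℕ 4)
    ≡⟨ cong₂ _*_ (ℤP.pos-* ν ν) (ℤP.pos-+ (m *ℕ p *ℕ (m *ℕ p)) 4) ⟩
  + ν * + ν * (+ (m *ℕ p *ℕ (m *ℕ p)) + + 4)
    ≡⟨ cong (λ x → + ν * + ν * (x + + 4)) (ℤP.pos-* (m *ℕ p) _) ⟩
  + ν * + ν * disc (+ (m *ℕ p))              ≡⟨ cong (λ K → + ν * + ν * disc K) (ℤP.pos-* m p) ⟩
  + ν * + ν * disc (+ m * + p)               ∎
  where open ≡-Reasoning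

IsA→Floor : ∀ m p ν {x} → IsA (m *ℕ p) p ν x →
            Floor (+ 2 - + m * + p) (+ 2 * + p) (+ ν) (+ ν * + ν * disc (+ m * + p)) x
IsA→Floor m p ν =
  Floor-cong {ν = + ν} (cong (λ K → + 2 - K) (ℤP.pos-* m p)) (ℤP.pos-* 2 p) refl (pos-bound ν m p)

IsB→Floor : ∀ m p ν {x} → IsB (m *ℕ p) p ν x →
            Floor (+ 2 + + m * + p) (+ 2 * + p) (+ ν) (+ ν * + ν * disc (+ m * + p)) x
IsB→Floor m p ν =
  Floor-cong {ν = + ν} (cong (λ K → + 2 + K) (ℤP.pos-* m p)) (ℤP.pos-* 2 p) refl (pos-bound ν m p)

no-integer-root : ∀ n m p → 1 ≤ℕ n → 1 ≤ℕ m *ℕ p → ∀ t → t * t ≢ + n * + n * disc (+ m * + p)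
no-integer-root n m p 1≤n 1≤K t t²≡ = not-square ∣ t ∣ n (m *ℕ p) 1≤n 1≤K (begin
  ∣ t ∣ *ℕ ∣ t ∣                       ≡⟨ sym (ℤP.abs-* t t) ⟩
  ∣ t * t ∣                            ≡⟨ cong ∣_∣ (trans t²≡ (sym (pos-bound n m p))) ⟩
  n *ℕ n *ℕ (m *ℕ p *ℕ (m *ℕ p) +ℕ 4)  ∎)
  where open ≡-Reasoning

theorem5p1 : (m p : ℕ) → 1 ≤ℕ m → 1 ≤ℕ p →
    (a b : ℕ → ℤ) →
    (∀ n → IsA (m *ℕ p) p n (a n)) →
    (∀ n → IsB (m *ℕ p) p n (b n)) →
    (n : ℕ) → 1 ≤ℕ n →
    Σ ℕ (λ k →
      (+ m * + k ≡ a n + (+ (m *ℕ p) - + 1) * b n)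
      × (a k ≡ b n - + 1)
      × (∀ j → a j ≡ b n - + 1 → j ≤ℕ k))
theorem5p1 m p 1≤m 1≤p a b isA isB n 1≤n = ∣ k ∣ , weight , a[k]≡b-1 , maximal
  where
  open BeattyPair (+ m) (+ p) (+ n) (b n) (+≤+ 1≤m) (+≤+ 1≤p) (+≤+ 1≤n)
    (no-integer-root n m p 1≤n (ℕP.*-mono-≤ 1≤m 1≤p)) (IsB→Floor m p n (isB n))
  +∣k∣≡k : + ∣ k ∣ ≡ k
  +∣k∣≡k = ℤP.0≤i⇒+∣i∣≡i 0≤k
  a[n]≡ : a n ≡ b n - + m * + n
  a[n]≡ = a-unique (+ n) (IsA→Floor m p n (isA n)) a-floor-at-n
  weight : + m * + ∣ k ∣ ≡ a n + (+ (m *ℕ p) - + 1) * b n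
  weight = begin
    + m * + ∣ k ∣                                ≡⟨ cong (+ m *_) +∣k∣≡k ⟩
    + m * k                                      ≡⟨ Mk≡ ⟩
    (b n - + m * + n) + (+ m * + p - + 1) * b n
      ≡⟨ cong₂ (λ x y → x + (y - + 1) * b n) (sym a[n]≡) (sym (ℤP.pos-* m p)) ⟩
    a n + (+ (m *ℕ p) - + 1) * b n               ∎
    where open ≡-Reasoning
  a[k]≡b-1 : a ∣ k ∣ ≡ b n - + 1
  a[k]≡b-1 = a-unique (+ ∣ k ∣) (IsA→Floor m p ∣ k ∣ (isA ∣ k ∣))
    (subst (λ ν → Floor (+ 2 - K) (+ 2 * + p) ν (ν * ν * D) (b n - + 1)) (sym +∣k∣≡k) a-floor-at-k)
  maximal : ∀ j → a j ≡ b n - + 1 → j ≤ℕ ∣ k ∣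
  maximal j a[j]≡b-1 = ℤP.drop‿+≤+ (subst (+ j ≤_) (sym +∣k∣≡k) (k-maximal (+ j)
    (subst (Floor (+ 2 - K) (+ 2 * + p) (+ j) (+ j * + j * D)) a[j]≡b-1 (IsA→Floor m p j (isA j)))))
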